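{- Let $B$ be a chord diagram with $n$ chords, viewed as a fixed-point-free involution $\alpha_B$ of $\{1,\dots,2n\}$. Then substituting $C_m:=N$ for all $m=1,2,3,\dots$ into $w_{\mathfrak{gl}}(\alpha_B)$ gives $N^{n}=N^{|V(\gamma(B))|}$. In other words, the graph invariant $G\mapsto N^{|V(G)|}$ on intersection graphs of chord diagrams is induced from the $\mathfrak{gl}$-weight system by this substitution.
   Context: For a positive integer $N$, let $E_{ij}$ be the matrix units of $\mathfrak{gl}(N)$. For $\alpha\in\mathbb S_m$ set $w_{\mathfrak{gl}(N)}(\alpha)=\sum_{i_1,\dots,i_m=1}^N E_{i_1i_{\alpha(1)}}\cdots E_{i_mi_{\alpha(m)}}\in U\mathfrak{gl}(N)$, and $C_k^{(N)}=w_{\mathfrak{gl}(N)}((1,2,\dots,k))$. The universal $\mathfrak{gl}$-weight system $w_{\mathfrak{gl}}(\alpha)$ is the (unique; existence by a theorem of Z. Yang) polynomial in $\mathbb C[N,C_1,C_2,\dots]$ such that for every positive integer $N$, substituting this integer for $N$ and $C_k^{(N)}$ for $C_k$ yields $w_{\mathfrak{gl}(N)}(\alpha)$. A chord diagram with $n$ chords is $2n$ points on an oriented circle split into $n$ pairs; numbering the points along the circle gives a fixed-point-free involution. Its intersection graph $\gamma(B)$ has the chords as vertices, two joined iff their endpoints alternate. -}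

module Defs where

open import Data.Nat as ℕ using (ℕ; zero; suc; NonZero)
open import Data.Nat.DivMod using (_%_; m%n<n)
open import Data.Integer as ℤ using (ℤ; +_)
open import Data.Fin as Fin using (Fin; toℕ; fromℕ<)
open import Data.Vec using (Vec; []; _∷_; lookup)
open import Data.List using (List; []; _∷_; [_]; map; foldr; concatMap; allFin)
open import Data.Bool using (if_then_else_)
open import Relation.Nullary.Decidable using (⌊_⌋)
open import Relation.Binary.PropositionalEquality using (_≡_; _≢_)

-- Chord diagrams with n chords: fixed-point-free involutions of
-- {1,…,2n}, here modelled as Fin (2 * n) = {0,…,2n-1} (point t+1 ↦ t).

record ChordDiagram (n : ℕ) : Set where
  field
    α            : Fin (2 ℕ.* n) → Fin (2 ℕ.* n)
    involutive   : ∀ x → α (α x) ≡ x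
    fixedPtFree  : ∀ x → α x ≢ x
open ChordDiagram public

-- The universal enveloping algebra U(gl(N)) over ℤ, presented as the
-- free associative unital ℤ-algebra on generators E_ij modulo the
-- relations [E_ij , E_kl] = δ_jk E_il − δ_li E_kj.

infixl 6 _⊕_
infixl 7 _⊗_
infix  4 _≈U_

data UTerm (N : ℕ) : Set where
  E   : Fin N → Fin N → UTerm N
  cst : ℤ → UTerm N
  _⊕_ : UTerm N → UTerm N → UTerm N
  _⊗_ : UTerm N → UTerm N → UTerm N
  ⊖_  : UTerm N → UTerm N

δ : ∀ {N} → Fin N → Fin N → UTerm N
δ i j = if ⌊ i Fin.≟ j ⌋ then cst (+ 1) else cst (+ 0)

data _≈U_ {N : ℕ} : UTerm N → UTerm N → Set where
  ≈refl   : ∀ {x} → x ≈U x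
  ≈sym    : ∀ {x y} → x ≈U y → y ≈U x
  ≈trans  : ∀ {x y z} → x ≈U y → y ≈U z → x ≈U z
  ⊕-cong  : ∀ {x x′ y y′} → x ≈U x′ → y ≈U y′ → x ⊕ y ≈U x′ ⊕ y′
  ⊗-cong  : ∀ {x x′ y y′} → x ≈U x′ → y ≈U y′ → x ⊗ y ≈U x′ ⊗ y′
  ⊖-cong  : ∀ {x x′} → x ≈U x′ → ⊖ x ≈U ⊖ x′
  ⊕-assoc : ∀ x y z → (x ⊕ y) ⊕ z ≈U x ⊕ (y ⊕ z)
  ⊕-comm  : ∀ x y → x ⊕ y ≈U y ⊕ x
  ⊕-idˡ   : ∀ x → cst (+ 0) ⊕ x ≈U x
  ⊕-invˡ  : ∀ x → (⊖ x) ⊕ x ≈U cst (+ 0)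
  ⊗-assoc : ∀ x y z → (x ⊗ y) ⊗ z ≈U x ⊗ (y ⊗ z)
  ⊗-idˡ   : ∀ x → cst (+ 1) ⊗ x ≈U x
  ⊗-idʳ   : ∀ x → x ⊗ cst (+ 1) ≈U x
  distribˡ : ∀ x y z → x ⊗ (y ⊕ z) ≈U x ⊗ y ⊕ x ⊗ z
  distribʳ : ∀ x y z → (y ⊕ z) ⊗ x ≈U y ⊗ x ⊕ z ⊗ x
  cst-+   : ∀ a b → cst a ⊕ cst b ≈U cst (a ℤ.+ b)
  cst-*   : ∀ a b → cst a ⊗ cst b ≈U cst (a ℤ.* b)
  cst-central : ∀ a x → cst a ⊗ x ≈U x ⊗ cst a
  commutator : ∀ i j k l →
    E i j ⊗ E k l ≈U E k l ⊗ E i j ⊕ (δ j k ⊗ E i l ⊕ ⊖ (δ l i ⊗ E k j))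

sumU : ∀ {N} → List (UTerm N) → UTerm N
sumU = foldr _⊕_ (cst (+ 0))

prodU : ∀ {N} → List (UTerm N) → UTerm N
prodU = foldr _⊗_ (cst (+ 1))

allTuples : (N m : ℕ) → List (Vec (Fin N) m)
allTuples N zero    = [ [] ]
allTuples N (suc m) = concatMap (λ a → map (a ∷_) (allTuples N m)) (allFin N)

wGLN : (N m : ℕ) → (Fin m → Fin m) → UTerm N
wGLN N m α = sumU (map (λ v → prodU (map (λ t → E (lookup v t) (lookup v (α t))) (allFin m)))
                       (allTuples N m))

-- the cycle (1 2 … k) on Fin k (0-based: t ↦ t+1 mod k)
cyc : (k : ℕ) → Fin k → Fin k
cyc (suc k) t = fromℕ< (m%n<n (suc (toℕ t)) (suc k))

Cgl : (N k : ℕ) → .{{NonZero k}} → UTerm N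
Cgl N (suc k) = wGLN N (suc k) (cyc (suc k))

-- Polynomials in ℤ[N, C₁, C₂, …] as expression terms.
-- varC k stands for the variable C_{k+1}.

data Poly : Set where
  coef : ℤ → Poly
  varN : Poly
  varC : ℕ → Poly
  _:+_ : Poly → Poly → Poly
  _:*_ : Poly → Poly → Poly
  :-_  : Poly → Poly

evalU : (N : ℕ) → Poly → UTerm N
evalU N (coef a)  = cst a
evalU N varN      = cst (+ N)
evalU N (varC k)  = Cgl N (suc k)
evalU N (p :+ q)  = evalU N p ⊕ evalU N q
evalU N (p :* q)  = evalU N p ⊗ evalU N q
evalU N (:- p)    = ⊖ evalU N p

IsUniversalGL : (m : ℕ) → (Fin m → Fin m) → Poly → Set
IsUniversalGL m α P = (N : ℕ) → .{{NonZero N}} → evalU N P ≈U wGLN N m α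

evalCN : ℤ → Poly → ℤ
evalCN N (coef a)  = a
evalCN N varN      = N
evalCN N (varC k)  = N
evalCN N (p :+ q)  = evalCN N p ℤ.+ evalCN N q
evalCN N (p :* q)  = evalCN N p ℤ.* evalCN N q
evalCN N (:- p)    = ℤ.- evalCN N p

-- The trace E i j ↦ δ i j kills commutators, so it extends to a character χ of U(gl(N)) into ℤ.
-- On w_gl(N)(α) = Σ_v Π_t E (v t) (v (α t)) it counts the colourings v : Fin m → Fin N that
-- are constant on the orbits of α, that is N ^ (number of cycles of α); summing out one
-- coordinate at a time computes this count. Hence χ sends C_k to N, and the universal
-- polynomial P to P evaluated at C_m := N. For a chord diagram α B is a fixed-point-free
-- involution with n orbits, so this evaluation equals N ^ n at every positive integer N.
-- Both sides are polynomial functions of N, and a polynomial function ℤ → ℤ vanishing on the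
-- positive integers vanishes everywhere, since its successive finite differences do.

module Submission where

module FiniteDifferences where

  open import Data.Nat as ℕ using (ℕ; zero; suc; _≤_; z≤n; s≤s; _⊔_)
  import Data.Nat.Properties as ℕ
  open import Data.Integer using (ℤ; +_; +[1+_]; -[1+_]; _+_; _*_; -_; _-_; _^_; 0ℤ; 1ℤ)
    renaming (suc to sucℤ)
  import Data.Integer.Properties as ℤ
  open import Data.Integer.Tactic.RingSolver using (solve-∀)
  open import Function using (_∘_)
  open import Relation.Binary.PropositionalEquality

  Δ : (ℤ → ℤ) → ℤ → ℤ
  Δ f x = f (sucℤ x) - f x

  data Degree≤ : ℕ → (ℤ → ℤ) → Set where
    constant   : ∀ {f} → (∀ x → f (sucℤ x) ≡ f x) → Degree≤ 0 f
    difference : ∀ {d f} → Degree≤ d (Δ f) → Degree≤ (suc d) f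

  Δ-+ : ∀ f g x → Δ (λ y → f y + g y) x ≡ Δ f x + Δ g x
  Δ-+ f g x = identity (f (sucℤ x)) (g (sucℤ x)) (f x) (g x)
    where
    identity : ∀ a b c d → (a + b) - (c + d) ≡ (a - c) + (b - d)
    identity = solve-∀

  Δ-neg : ∀ f x → Δ (λ y → - f y) x ≡ - Δ f x
  Δ-neg f x = identity (f (sucℤ x)) (f x)
    where
    identity : ∀ a c → (- a) - (- c) ≡ - (a - c)
    identity = solve-∀

  Δ-*ˡ : ∀ k f x → Δ (λ y → k * f y) x ≡ k * Δ f x
  Δ-*ˡ k f x = identity k (f (sucℤ x)) (f x)
    where
    identity : ∀ k a c → k * a - k * c ≡ k * (a - c)
    identity = solve-∀

  Δ-* : ∀ f g x → Δ (λ y → f y * g y) x ≡ Δ f x * g (sucℤ x) + f x * Δ g x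
  Δ-* f g x = identity (f (sucℤ x)) (g (sucℤ x)) (f x) (g x)
    where
    identity : ∀ a b c d → a * b - c * d ≡ (a - c) * b + c * (b - d)
    identity = solve-∀

  Δ-id : ∀ x → Δ (λ y → y) x ≡ 1ℤ
  Δ-id x = identity x
    where
    identity : ∀ x → (1ℤ + x) - x ≡ 1ℤ
    identity = solve-∀

  Δ-constant : ∀ {f : ℤ → ℤ} → (∀ x → f (sucℤ x) ≡ f x) → ∀ x → Δ f x ≡ 0ℤ
  Δ-constant {f} c x = trans (cong (_- f x) (c x)) (ℤ.+-inverseʳ (f x))

  shift-invariant⇒constant : ∀ {f : ℤ → ℤ} → (∀ x → f (sucℤ x) ≡ f x) → ∀ x → f x ≡ f 0ℤ
  shift-invariant⇒constant c (+ zero)     = refl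
  shift-invariant⇒constant c +[1+ n ]     = trans (c (+ n)) (shift-invariant⇒constant c (+ n))
  shift-invariant⇒constant c -[1+ zero ]  = sym (c -[1+ zero ])
  shift-invariant⇒constant c -[1+ suc n ] =
    trans (sym (c -[1+ suc n ])) (shift-invariant⇒constant c -[1+ n ])

  Degree≤-cong : ∀ {d f g} → f ≗ g → Degree≤ d f → Degree≤ d g
  Degree≤-cong f≗g (constant c)   = constant (λ x → trans (sym (f≗g _)) (trans (c x) (f≗g x)))
  Degree≤-cong f≗g (difference D) =
    difference (Degree≤-cong (λ x → cong₂ _-_ (f≗g _) (f≗g x)) D)

  Degree≤-step : ∀ {d f} → Degree≤ d f → Degree≤ (suc d) f
  Degree≤-step (constant c)   =
    difference (constant (λ x → trans (Δ-constant c (sucℤ x)) (sym (Δ-constant c x))))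
  Degree≤-step (difference D) = difference (Degree≤-step D)

  Degree≤-weaken : ∀ {d e f} → d ≤ e → Degree≤ d f → Degree≤ e f
  Degree≤-weaken {e = zero}  z≤n D              = D
  Degree≤-weaken {e = suc e} z≤n D              = Degree≤-step (Degree≤-weaken z≤n D)
  Degree≤-weaken (s≤s d≤e)       (difference D) = difference (Degree≤-weaken d≤e D)

  Degree≤-∘sucℤ : ∀ {d f} → Degree≤ d f → Degree≤ d (f ∘ sucℤ)
  Degree≤-∘sucℤ (constant c)   = constant (c ∘ sucℤ)
  Degree≤-∘sucℤ (difference D) = difference (Degree≤-∘sucℤ D)

  Degree≤-+ : ∀ {d f g} → Degree≤ d f → Degree≤ d g → Degree≤ d (λ x → f x + g x)
  Degree≤-+ (constant c) (constant c′) = constant (λ x → cong₂ _+_ (c x) (c′ x))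
  Degree≤-+ {f = f} {g} (difference D) (difference D′) =
    difference (Degree≤-cong (λ x → sym (Δ-+ f g x)) (Degree≤-+ D D′))

  Degree≤-neg : ∀ {d f} → Degree≤ d f → Degree≤ d (λ x → - f x)
  Degree≤-neg (constant c)           = constant (λ x → cong -_ (c x))
  Degree≤-neg {f = f} (difference D) =
    difference (Degree≤-cong (λ x → sym (Δ-neg f x)) (Degree≤-neg D))

  Degree≤-*ˡ : ∀ k {d f} → Degree≤ d f → Degree≤ d (λ x → k * f x)
  Degree≤-*ˡ k (constant c)           = constant (λ x → cong (k *_) (c x))
  Degree≤-*ˡ k {f = f} (difference D) =
    difference (Degree≤-cong (λ x → sym (Δ-*ˡ k f x)) (Degree≤-*ˡ k D))

  Degree≤-* : ∀ {a b f g} → Degree≤ a f → Degree≤ b g → Degree≤ (a ℕ.+ b) (λ x → f x * g x)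
  Degree≤-* {f = f} {g} (constant c) G =
    Degree≤-cong (λ x → cong (_* g x) (sym (shift-invariant⇒constant c x))) (Degree≤-*ˡ (f 0ℤ) G)
  Degree≤-* {a = suc a} {f = f} {g} F (constant c) =
    subst (λ e → Degree≤ e (λ x → f x * g x)) (sym (ℕ.+-identityʳ (suc a)))
      (Degree≤-cong g₀f≗fg (Degree≤-*ˡ (g 0ℤ) F))
    where
    g₀f≗fg : (λ x → g 0ℤ * f x) ≗ (λ x → f x * g x)
    g₀f≗fg x = trans (ℤ.*-comm (g 0ℤ) (f x)) (cong (f x *_) (sym (shift-invariant⇒constant c x)))
  Degree≤-* {a = suc a} {suc b} {f} {g} F@(difference ΔF) G@(difference ΔG) =
    difference (Degree≤-cong (λ x → sym (Δ-* f g x))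
      (Degree≤-+ (Degree≤-* ΔF (Degree≤-∘sucℤ G))
                 (subst (λ e → Degree≤ e (λ x → f x * Δ g x)) (sym (ℕ.+-suc a b))
                   (Degree≤-* F ΔG))))

  Degree≤-id : Degree≤ 1 (λ x → x)
  Degree≤-id = difference (constant (λ x → trans (Δ-id (sucℤ x)) (sym (Δ-id x))))

  Degree≤-^ : ∀ n → Degree≤ n (_^ n)
  Degree≤-^ zero    = constant (λ _ → refl)
  Degree≤-^ (suc n) = Degree≤-* Degree≤-id (Degree≤-^ n)

  vanishOnPositives⇒≡0 : ∀ {d g} → Degree≤ d g → (∀ k → g +[1+ k ] ≡ 0ℤ) → ∀ x → g x ≡ 0ℤ
  vanishOnPositives⇒≡0 (constant c) g⁺≡0 x =
    trans (shift-invariant⇒constant c x) (trans (sym (c 0ℤ)) (g⁺≡0 0))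
  vanishOnPositives⇒≡0 {g = g} (difference D) g⁺≡0 =
    vanishOnPositives⇒≡0 (constant (λ x → ℤ.i-j≡0⇒i≡j _ _ (Δg≡0 x))) g⁺≡0
    where
    Δg≡0 : ∀ x → Δ g x ≡ 0ℤ
    Δg≡0 = vanishOnPositives⇒≡0 D (λ k → cong₂ _-_ (g⁺≡0 (suc k)) (g⁺≡0 k))

  agreeOnPositives⇒≗ : ∀ {a b f g} → Degree≤ a f → Degree≤ b g →
                       (∀ k → f +[1+ k ] ≡ g +[1+ k ]) → f ≗ g
  agreeOnPositives⇒≗ {a} {b} {f} {g} F G f⁺≡g⁺ x =
    ℤ.i-j≡0⇒i≡j _ _ (vanishOnPositives⇒≡0 f-g f⁺-g⁺≡0 x)
    where
    f-g : Degree≤ (a ⊔ b) (λ x → f x - g x)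
    f-g = Degree≤-+ (Degree≤-weaken (ℕ.m≤m⊔n a b) F) (Degree≤-neg (Degree≤-weaken (ℕ.m≤n⊔m a b) G))
    f⁺-g⁺≡0 : ∀ k → f +[1+ k ] - g +[1+ k ] ≡ 0ℤ
    f⁺-g⁺≡0 k = trans (cong (_- g +[1+ k ]) (f⁺≡g⁺ k)) (ℤ.+-inverseʳ (g +[1+ k ]))

module TraceCharacter where

  open import Defs
  open import Data.Nat as ℕ using (ℕ; zero; suc)
  import Data.Nat.Properties as ℕ
  open import Data.Nat.DivMod using (_%_; m%n<n; m<n⇒m%n≡m; n%n≡0)
  open import Data.Integer using (ℤ; +_; _+_; _*_; -_; _^_; 0ℤ; 1ℤ)
  import Data.Integer.Properties as ℤ
  open import Data.Fin as Fin using (Fin; zero; suc; toℕ)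
  import Data.Fin.Properties as Fin
  open import Data.Vec using (Vec; []; _∷_; lookup)
  open import Data.List using (List; []; _∷_; map; _++_; concatMap; tabulate; allFin)
  import Data.List.Properties as List
  open import Data.Empty using (⊥-elim)
  open import Data.Sum using (inj₁; inj₂)
  open import Function using (_∘_)
  open import Relation.Nullary using (yes; no)
  open import Relation.Binary.PropositionalEquality
  open ≡-Reasoning

  open import Algebra.Properties.Semiring.Sum ℤ.+-*-semiring
    using (sum-syntax; sum-cong-≗; sum-replicate-zero; ∑-comm)
  open import Algebra.Properties.Monoid.Sum ℤ.*-1-monoid
    using () renaming (sum to ∏; sum-cong-≗ to ∏-cong)
  import Algebra.Properties.Semiring.Sum ℕ.+-*-semiring as ℕΣ

  δᶠ : ∀ {n} → Fin n → Fin n → ℕ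
  δᶠ zero    zero    = 1
  δᶠ zero    (suc _) = 0
  δᶠ (suc _) zero    = 0
  δᶠ (suc i) (suc j) = δᶠ i j

  δᶠ-refl : ∀ {n} (i : Fin n) → δᶠ i i ≡ 1
  δᶠ-refl zero    = refl
  δᶠ-refl (suc i) = δᶠ-refl i

  δᶠ-sym : ∀ {n} (i j : Fin n) → δᶠ i j ≡ δᶠ j i
  δᶠ-sym zero    zero    = refl
  δᶠ-sym zero    (suc _) = refl
  δᶠ-sym (suc _) zero    = refl
  δᶠ-sym (suc i) (suc j) = δᶠ-sym i j

  δᶠ-≢ : ∀ {n} {i j : Fin n} → i ≢ j → δᶠ i j ≡ 0
  δᶠ-≢ {i = zero}  {zero}  i≢j = ⊥-elim (i≢j refl)
  δᶠ-≢ {i = zero}  {suc _} _   = refl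
  δᶠ-≢ {i = suc _} {zero}  _   = refl
  δᶠ-≢ {i = suc _} {suc _} i≢j = δᶠ-≢ (i≢j ∘ cong suc)

  ∑-δᶠ : ∀ {n} (c : Fin n) → ℕΣ.sum (λ a → δᶠ a c) ≡ 1
  ∑-δᶠ {suc n} zero    = cong suc (ℕΣ.sum-replicate-zero n)
  ∑-δᶠ {suc n} (suc c) = ∑-δᶠ c

  ∑-δᶠ-* : ∀ {n} (c : Fin n) (G : Fin n → ℤ) → ∑[ a < n ] (+ δᶠ a c * G a) ≡ G c
  ∑-δᶠ-* {suc n} zero G = begin
    1ℤ * G zero + ∑[ a < n ] (0ℤ * G (suc a))
      ≡⟨ cong₂ _+_ (ℤ.*-identityˡ (G zero)) (sum-cong-≗ (ℤ.*-zeroˡ ∘ G ∘ suc)) ⟩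
    G zero + ∑[ a < n ] 0ℤ
      ≡⟨ cong (_+_ (G zero)) (sum-replicate-zero n) ⟩
    G zero + 0ℤ
      ≡⟨ ℤ.+-identityʳ (G zero) ⟩
    G zero ∎
  ∑-δᶠ-* {suc n} (suc c) G =
    trans (cong₂ _+_ (ℤ.*-zeroˡ (G zero)) (∑-δᶠ-* c (G ∘ suc))) (ℤ.+-identityˡ (G (suc c)))

  ∑-const : ∀ n x → ∑[ a < n ] x ≡ + n * x
  ∑-const zero    x = sym (ℤ.*-zeroˡ x)
  ∑-const (suc n) x = trans (cong (_+_ x) (∑-const n x)) (sym (ℤ.suc-* (+ n) x))

  module _ {N : ℕ} where

    χ : UTerm N → ℤ
    χ (E i j) = + δᶠ i j
    χ (cst a) = a
    χ (x ⊕ y) = χ x + χ y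
    χ (x ⊗ y) = χ x * χ y
    χ (⊖ x)   = - χ x

    χ-δ : ∀ (i j : Fin N) → χ (δ i j) ≡ + δᶠ i j
    χ-δ i j with i Fin.≟ j
    ... | yes refl = cong +_ (sym (δᶠ-refl i))
    ... | no i≢j   = cong +_ (sym (δᶠ-≢ i≢j))

    χ-commutator : ∀ i j k l → χ (δ j k ⊗ E i l ⊕ ⊖ (δ l i ⊗ E k j)) ≡ 0ℤ
    χ-commutator i j k l = begin
      χ (δ j k) * + δᶠ i l + - (χ (δ l i) * + δᶠ k j)
        ≡⟨ cong₂ (λ u v → u * + δᶠ i l + - (v * + δᶠ k j)) (χ-δ j k) (χ-δ l i) ⟩
      + δᶠ j k * + δᶠ i l + - (+ δᶠ l i * + δᶠ k j)
        ≡⟨ cong₂ (λ u v → + δᶠ j k * + δᶠ i l + - (+ u * + v)) (δᶠ-sym l i) (δᶠ-sym k j) ⟩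
      + δᶠ j k * + δᶠ i l + - (+ δᶠ i l * + δᶠ j k)
        ≡⟨ cong (λ u → + δᶠ j k * + δᶠ i l + - u) (ℤ.*-comm (+ δᶠ i l) (+ δᶠ j k)) ⟩
      + δᶠ j k * + δᶠ i l + - (+ δᶠ j k * + δᶠ i l)
        ≡⟨ ℤ.+-inverseʳ (+ δᶠ j k * + δᶠ i l) ⟩
      0ℤ ∎

    χ-resp-≈U : ∀ {x y} → x ≈U y → χ x ≡ χ y
    χ-resp-≈U ≈refl              = refl
    χ-resp-≈U (≈sym p)           = sym (χ-resp-≈U p)
    χ-resp-≈U (≈trans p q)       = trans (χ-resp-≈U p) (χ-resp-≈U q)
    χ-resp-≈U (⊕-cong p q)       = cong₂ _+_ (χ-resp-≈U p) (χ-resp-≈U q)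
    χ-resp-≈U (⊗-cong p q)       = cong₂ _*_ (χ-resp-≈U p) (χ-resp-≈U q)
    χ-resp-≈U (⊖-cong p)         = cong -_ (χ-resp-≈U p)
    χ-resp-≈U (⊕-assoc x y z)    = ℤ.+-assoc (χ x) (χ y) (χ z)
    χ-resp-≈U (⊕-comm x y)       = ℤ.+-comm (χ x) (χ y)
    χ-resp-≈U (⊕-idˡ x)          = ℤ.+-identityˡ (χ x)
    χ-resp-≈U (⊕-invˡ x)         = ℤ.+-inverseˡ (χ x)
    χ-resp-≈U (⊗-assoc x y z)    = ℤ.*-assoc (χ x) (χ y) (χ z)
    χ-resp-≈U (⊗-idˡ x)          = ℤ.*-identityˡ (χ x)
    χ-resp-≈U (⊗-idʳ x)          = ℤ.*-identityʳ (χ x)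
    χ-resp-≈U (distribˡ x y z)   = ℤ.*-distribˡ-+ (χ x) (χ y) (χ z)
    χ-resp-≈U (distribʳ x y z)   = ℤ.*-distribʳ-+ (χ x) (χ y) (χ z)
    χ-resp-≈U (cst-+ a b)        = refl
    χ-resp-≈U (cst-* a b)        = refl
    χ-resp-≈U (cst-central a x)  = ℤ.*-comm a (χ x)
    χ-resp-≈U (commutator i j k l) = begin
      + δᶠ i j * + δᶠ k l             ≡⟨ ℤ.*-comm (+ δᶠ i j) (+ δᶠ k l) ⟩
      + δᶠ k l * + δᶠ i j             ≡⟨ ℤ.+-identityʳ _ ⟨
      + δᶠ k l * + δᶠ i j + 0ℤ        ≡⟨ cong (_+_ (+ δᶠ k l * + δᶠ i j)) (χ-commutator i j k l) ⟨
      χ (E k l ⊗ E i j ⊕ (δ j k ⊗ E i l ⊕ ⊖ (δ l i ⊗ E k j))) ∎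

    χ-sumU-concatMap : ∀ {A : Set} {n} (f : A → List (UTerm N)) (g : Fin n → A) →
                       χ (sumU (concatMap f (tabulate g))) ≡ ∑[ a < n ] χ (sumU (f (g a)))
    χ-sumU-concatMap {n = zero}  f g = refl
    χ-sumU-concatMap {n = suc n} f g = begin
      χ (sumU (f (g zero) ++ concatMap f (tabulate (g ∘ suc))))
        ≡⟨ χ-sumU-++ (f (g zero)) _ ⟩
      χ (sumU (f (g zero))) + χ (sumU (concatMap f (tabulate (g ∘ suc))))
        ≡⟨ cong (_+_ (χ (sumU (f (g zero))))) (χ-sumU-concatMap f (g ∘ suc)) ⟩
      χ (sumU (f (g zero))) + ∑[ a < n ] χ (sumU (f (g (suc a)))) ∎
      where
      χ-sumU-++ : ∀ xs ys → χ (sumU (xs ++ ys)) ≡ χ (sumU xs) + χ (sumU ys)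
      χ-sumU-++ []       ys = sym (ℤ.+-identityˡ _)
      χ-sumU-++ (x ∷ xs) ys =
        trans (cong (_+_ (χ x)) (χ-sumU-++ xs ys)) (sym (ℤ.+-assoc (χ x) _ _))

    χ-prodU-tabulate : ∀ {n} (g : Fin n → UTerm N) → χ (prodU (tabulate g)) ≡ ∏ (χ ∘ g)
    χ-prodU-tabulate {zero}  g = refl
    χ-prodU-tabulate {suc n} g = cong (χ (g zero) *_) (χ-prodU-tabulate (g ∘ suc))

    sumᵀ : ∀ m → (Vec (Fin N) m → ℤ) → ℤ
    sumᵀ zero    G = G []
    sumᵀ (suc m) G = ∑[ a < N ] sumᵀ m (λ w → G (a ∷ w))

    sumᵀ-cong : ∀ m {F G : Vec (Fin N) m → ℤ} → F ≗ G → sumᵀ m F ≡ sumᵀ m G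
    sumᵀ-cong zero    F≗G = F≗G []
    sumᵀ-cong (suc m) F≗G = sum-cong-≗ (λ a → sumᵀ-cong m (λ w → F≗G (a ∷ w)))

    ∑-sumᵀ-comm : ∀ m {n} (F : Fin n → Vec (Fin N) m → ℤ) →
                  ∑[ a < n ] sumᵀ m (F a) ≡ sumᵀ m (λ w → ∑[ a < n ] F a w)
    ∑-sumᵀ-comm zero    F = refl
    ∑-sumᵀ-comm (suc m) F = trans (∑-comm (λ a b → sumᵀ m (λ w → F a (b ∷ w))))
                                  (sum-cong-≗ (λ b → ∑-sumᵀ-comm m (λ a w → F a (b ∷ w))))

    χ-sumU-allTuples : ∀ m (T : Vec (Fin N) m → UTerm N) →
                       χ (sumU (map T (allTuples N m))) ≡ sumᵀ m (χ ∘ T)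
    χ-sumU-allTuples zero    T = ℤ.+-identityʳ (χ (T []))
    χ-sumU-allTuples (suc m) T = begin
      χ (sumU (map T (concatMap (λ a → map (a ∷_) (allTuples N m)) (allFin N))))
        ≡⟨ cong (χ ∘ sumU) (List.map-concatMap T _ (allFin N)) ⟩
      χ (sumU (concatMap (λ a → map T (map (a ∷_) (allTuples N m))) (allFin N)))
        ≡⟨ χ-sumU-concatMap (λ a → map T (map (a ∷_) (allTuples N m))) (λ a → a) ⟩
      ∑[ a < N ] χ (sumU (map T (map (a ∷_) (allTuples N m))))
        ≡⟨ sum-cong-≗ (λ a → cong (χ ∘ sumU) (List.map-∘ {g = T} {f = a ∷_} (allTuples N m))) ⟨
      ∑[ a < N ] χ (sumU (map (T ∘ (a ∷_)) (allTuples N m)))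
        ≡⟨ sum-cong-≗ (λ a → χ-sumU-allTuples m (T ∘ (a ∷_))) ⟩
      sumᵀ (suc m) (χ ∘ T) ∎

  collapse : ∀ {m} → Fin m → Fin (suc m) → Fin m
  collapse d zero    = d
  collapse d (suc s) = s

  merge : ∀ {m} → Fin m → (Fin (suc m) → Fin (suc m)) → Fin m → Fin m
  merge p α t = collapse p (α (suc t))

  -- Only used when α (suc t) ≢ zero, so the default t of collapse is never taken.
  restrict : ∀ {m} → (Fin (suc m) → Fin (suc m)) → Fin m → Fin m
  restrict α t = collapse t (α (suc t))

  cyc-merge : ∀ k → merge zero (cyc (suc (suc k))) ≗ cyc (suc k)
  cyc-merge k t = Fin.toℕ-injective (begin
    toℕ (collapse zero (cyc (suc (suc k)) (suc t)))
      ≡⟨ toℕ-collapse-zero (cyc (suc (suc k)) (suc t)) ⟩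
    toℕ (cyc (suc (suc k)) (suc t)) ℕ.∸ 1
      ≡⟨ cong (ℕ._∸ 1) (Fin.toℕ-fromℕ< (m%n<n (suc (suc (toℕ t))) (suc (suc k)))) ⟩
    suc (suc (toℕ t)) % suc (suc k) ℕ.∸ 1
      ≡⟨ %-shift (toℕ t) (ℕ.≤-pred (Fin.toℕ<n t)) ⟩
    suc (toℕ t) % suc k
      ≡⟨ Fin.toℕ-fromℕ< (m%n<n (suc (toℕ t)) (suc k)) ⟨
    toℕ (cyc (suc k) t) ∎)
    where
    toℕ-collapse-zero : (x : Fin (suc (suc k))) → toℕ (collapse zero x) ≡ toℕ x ℕ.∸ 1
    toℕ-collapse-zero zero    = refl
    toℕ-collapse-zero (suc x) = refl
    %-shift : ∀ a → a ℕ.≤ k → suc (suc a) % suc (suc k) ℕ.∸ 1 ≡ suc a % suc k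
    %-shift a a≤k with ℕ.m≤n⇒m<n∨m≡n a≤k
    ... | inj₁ a<k  =
      trans (cong (ℕ._∸ 1) (m<n⇒m%n≡m (ℕ.s<s (ℕ.s<s a<k)))) (sym (m<n⇒m%n≡m (ℕ.s<s a<k)))
    ... | inj₂ refl = trans (cong (ℕ._∸ 1) (n%n≡0 (suc (suc k)))) (sym (n%n≡0 (suc k)))

  fixedPoints : ∀ {m} → (Fin m → Fin m) → ℕ
  fixedPoints α = ℕΣ.sum (λ t → δᶠ (α t) t)

  module _ {m} {α : Fin (suc m) → Fin (suc m)} (α-inv : ∀ x → α (α x) ≡ x) where

    α-suc≢0 : α zero ≡ zero → ∀ t → α (suc t) ≢ zero
    α-suc≢0 α0≡0 t αt≡0 with () ← trans (sym (α-inv (suc t))) (trans (cong α αt≡0) α0≡0)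

    restrict-involutive : α zero ≡ zero → ∀ t → restrict α (restrict α t) ≡ t
    restrict-involutive α0≡0 t with α (suc t) in αt
    ... | zero  = ⊥-elim (α-suc≢0 α0≡0 t αt)
    ... | suc s = cong (collapse s) (trans (cong α (sym αt)) (α-inv (suc t)))

    fixedPoints-restrict : α zero ≡ zero → fixedPoints α ≡ suc (fixedPoints (restrict α))
    fixedPoints-restrict α0≡0 =
      cong₂ ℕ._+_ (cong (λ s → δᶠ s zero) α0≡0) (ℕΣ.sum-cong-≗ (λ t → sym (δᶠ-restrict t)))
      where
      δᶠ-restrict : ∀ t → δᶠ (restrict α t) t ≡ δᶠ (α (suc t)) (suc t)
      δᶠ-restrict t with α (suc t) in αt
      ... | zero  = ⊥-elim (α-suc≢0 α0≡0 t αt)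
      ... | suc s = refl

    module _ {p : Fin m} (α0≡p : α zero ≡ suc p) where

      merged-point : ∀ {t} → α (suc t) ≡ zero → t ≡ p
      merged-point {t} αt≡0 =
        Fin.suc-injective (trans (sym (α-inv (suc t))) (trans (cong α αt≡0) α0≡p))

      α-p≡0 : α (suc p) ≡ zero
      α-p≡0 = trans (cong α (sym α0≡p)) (α-inv zero)

      merge-involutive : ∀ t → merge p α (merge p α t) ≡ t
      merge-involutive t with α (suc t) in αt
      ... | zero  = trans (cong (collapse p) α-p≡0) (sym (merged-point αt))
      ... | suc s = cong (collapse p) (trans (cong α (sym αt)) (α-inv (suc t)))

      -- The 2-cycle (zero , suc p) of α becomes the fixed point p of merge p α.
      fixedPoints-merge : fixedPoints (merge p α) ≡ suc (fixedPoints α)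
      fixedPoints-merge = begin
        ℕΣ.sum (λ t → δᶠ (merge p α t) t)
          ≡⟨ ℕΣ.sum-cong-≗ δᶠ-merge ⟩
        ℕΣ.sum (λ t → δᶠ (α (suc t)) (suc t) ℕ.+ δᶠ t p)
          ≡⟨ ℕΣ.∑-distrib-+ (λ t → δᶠ (α (suc t)) (suc t)) (λ t → δᶠ t p) ⟩
        S ℕ.+ ℕΣ.sum (λ t → δᶠ t p)
          ≡⟨ cong (S ℕ.+_) (∑-δᶠ p) ⟩
        S ℕ.+ 1
          ≡⟨ ℕ.+-comm S 1 ⟩
        suc S
          ≡⟨ cong (λ s → suc (δᶠ s zero ℕ.+ S)) α0≡p ⟨
        suc (fixedPoints α) ∎
        where
        S = ℕΣ.sum (λ t → δᶠ (α (suc t)) (suc t))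
        δᶠ-merge : ∀ t → δᶠ (merge p α t) t ≡ δᶠ (α (suc t)) (suc t) ℕ.+ δᶠ t p
        δᶠ-merge t with α (suc t) in αt
        ... | zero  = δᶠ-sym p t
        ... | suc s = sym (trans (cong (δᶠ s t ℕ.+_) (δᶠ-≢ t≢p)) (ℕ.+-identityʳ (δᶠ s t)))
          where
          t≢p : t ≢ p
          t≢p refl with () ← trans (sym αt) α-p≡0

  module _ (N : ℕ) where

    -- The number of v : Fin m → Fin N with v t ≡ v (α t) for all t.
    colourings : ∀ {m} → (Fin m → Fin m) → ℤ
    colourings {m} α = sumᵀ {N} m (λ v → ∏ (λ t → + δᶠ (lookup v t) (lookup v (α t))))

    χ-wGLN : ∀ m α → χ (wGLN N m α) ≡ colourings α
    χ-wGLN m α = trans (χ-sumU-allTuples m (λ v → prodU (map (entry v) (allFin m))))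
                       (sumᵀ-cong m (λ v → trans (cong (χ ∘ prodU) (List.map-tabulate (λ t → t) (entry v)))
                                                 (χ-prodU-tabulate (entry v))))
      where
      entry : Vec (Fin N) m → Fin m → UTerm N
      entry v t = E (lookup v t) (lookup v (α t))

    colourings-cong : ∀ {m} {α β : Fin m → Fin m} → α ≗ β → colourings α ≡ colourings β
    colourings-cong {m} α≗β =
      sumᵀ-cong m (λ v → ∏-cong (λ t → cong (λ s → + δᶠ (lookup v t) (lookup v s)) (α≗β t)))

    lookup-collapse : ∀ {m} (w : Vec (Fin N) m) d x →
                      lookup (lookup w d ∷ w) x ≡ lookup w (collapse d x)
    lookup-collapse w d zero    = refl
    lookup-collapse w d (suc x) = refl

    -- Summing out v zero against the factor δ (v zero) (v (suc p)) substitutes v (suc p) for it.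
    colourings-merge : ∀ {m} {α : Fin (suc m) → Fin (suc m)} {p} → α zero ≡ suc p →
                       colourings α ≡ colourings (merge p α)
    colourings-merge {m} {α} {p} α0≡p = begin
      ∑[ a < N ] sumᵀ m (λ w → + δᶠ a (lookup (a ∷ w) (α zero)) * G a w)
        ≡⟨ sum-cong-≗ (λ a → sumᵀ-cong m (λ w →
             cong (λ s → + δᶠ a (lookup (a ∷ w) s) * G a w) α0≡p)) ⟩
      ∑[ a < N ] sumᵀ m (λ w → + δᶠ a (lookup w p) * G a w)
        ≡⟨ ∑-sumᵀ-comm m (λ a w → + δᶠ a (lookup w p) * G a w) ⟩
      sumᵀ m (λ w → ∑[ a < N ] (+ δᶠ a (lookup w p) * G a w))
        ≡⟨ sumᵀ-cong m (λ w → ∑-δᶠ-* (lookup w p) (λ a → G a w)) ⟩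
      sumᵀ m (λ w → G (lookup w p) w)
        ≡⟨ sumᵀ-cong m (λ w → ∏-cong (λ t →
             cong (λ s → + δᶠ (lookup w t) s) (lookup-collapse w p (α (suc t))))) ⟩
      colourings (merge p α) ∎
      where
      G : Fin N → Vec (Fin N) m → ℤ
      G a w = ∏ (λ t → + δᶠ (lookup w t) (lookup (a ∷ w) (α (suc t))))

    colourings-restrict : ∀ {m} {α : Fin (suc m) → Fin (suc m)} → α zero ≡ zero →
                          (∀ t → α (suc t) ≢ zero) → colourings α ≡ + N * colourings (restrict α)
    colourings-restrict {m} {α} α0≡0 avoids = begin
      ∑[ a < N ] sumᵀ m (λ w → + δᶠ a (lookup (a ∷ w) (α zero)) * G a w)
        ≡⟨ sum-cong-≗ (λ a → sumᵀ-cong m (λ w →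
             trans (cong₂ _*_ (loop a w) (G-restrict a w)) (ℤ.*-identityˡ _))) ⟩
      ∑[ a < N ] colourings (restrict α)
        ≡⟨ ∑-const N (colourings (restrict α)) ⟩
      + N * colourings (restrict α) ∎
      where
      G : Fin N → Vec (Fin N) m → ℤ
      G a w = ∏ (λ t → + δᶠ (lookup w t) (lookup (a ∷ w) (α (suc t))))
      loop : ∀ a w → + δᶠ a (lookup (a ∷ w) (α zero)) ≡ 1ℤ
      loop a w = trans (cong (λ s → + δᶠ a (lookup (a ∷ w) s)) α0≡0) (cong +_ (δᶠ-refl a))
      lookup-∷ : ∀ a (w : Vec (Fin N) m) t x → x ≢ zero →
                 lookup (a ∷ w) x ≡ lookup w (collapse t x)
      lookup-∷ a w t zero    x≢0 = ⊥-elim (x≢0 refl)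
      lookup-∷ a w t (suc x) _   = refl
      G-restrict : ∀ a w → G a w ≡ ∏ (λ t → + δᶠ (lookup w t) (lookup w (restrict α t)))
      G-restrict a w =
        ∏-cong (λ t → cong (λ s → + δᶠ (lookup w t) s) (lookup-∷ a w t (α (suc t)) (avoids t)))

    -- The hypothesis on e says that e is the number of orbits of α.
    colourings-involution : ∀ {m} {α : Fin m → Fin m} → (∀ x → α (α x) ≡ x) →
                            ∀ e → e ℕ.+ e ≡ m ℕ.+ fixedPoints α → colourings α ≡ (+ N) ^ e
    colourings-involution {zero}  _ zero    _  = refl
    colourings-involution {suc m} _ zero    ()
    colourings-involution {suc m} {α} α-inv (suc e) 2e≡ = by-cases (α zero) refl
      where
      by-cases : ∀ x → α zero ≡ x → colourings α ≡ (+ N) ^ suc e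
      by-cases zero α0 =
        trans (colourings-restrict {α = α} α0 (α-suc≢0 {α = α} α-inv α0))
              (cong (+ N *_)
                    (colourings-involution (restrict-involutive {α = α} α-inv α0) e 2e′≡))
        where
        2e′≡ : e ℕ.+ e ≡ m ℕ.+ fixedPoints (restrict α)
        2e′≡ = ℕ.suc-injective (begin
          suc (e ℕ.+ e)                         ≡⟨ ℕ.+-suc e e ⟨
          e ℕ.+ suc e                           ≡⟨ ℕ.suc-injective 2e≡ ⟩
          m ℕ.+ fixedPoints α                   ≡⟨ cong (m ℕ.+_) (fixedPoints-restrict {α = α} α-inv α0) ⟩
          m ℕ.+ suc (fixedPoints (restrict α))  ≡⟨ ℕ.+-suc m _ ⟩
          suc (m ℕ.+ fixedPoints (restrict α))  ∎)
      by-cases (suc p) α0 =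
        trans (colourings-merge {α = α} α0)
              (colourings-involution (merge-involutive {α = α} α-inv α0) (suc e) 2e≡′)
        where
        2e≡′ : suc e ℕ.+ suc e ≡ m ℕ.+ fixedPoints (merge p α)
        2e≡′ = trans 2e≡ (trans (sym (ℕ.+-suc m _))
                                (cong (m ℕ.+_) (sym (fixedPoints-merge {α = α} α-inv α0))))

    colourings-fixedPointFree : ∀ n {α : Fin (2 ℕ.* n) → Fin (2 ℕ.* n)} →
      (∀ x → α (α x) ≡ x) → (∀ x → α x ≢ x) → colourings α ≡ (+ N) ^ n
    colourings-fixedPointFree n {α} α-inv α-fpf = colourings-involution α-inv n (begin
      n ℕ.+ n                        ≡⟨ cong (n ℕ.+_) (ℕ.+-identityʳ n) ⟨
      2 ℕ.* n                        ≡⟨ ℕ.+-identityʳ (2 ℕ.* n) ⟨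
      2 ℕ.* n ℕ.+ 0                  ≡⟨ cong (2 ℕ.* n ℕ.+_) no-fixed-points ⟨
      2 ℕ.* n ℕ.+ fixedPoints α      ∎)
      where
      no-fixed-points : fixedPoints α ≡ 0
      no-fixed-points =
        trans (ℕΣ.sum-cong-≗ (λ t → δᶠ-≢ (α-fpf t))) (ℕΣ.sum-replicate-zero (2 ℕ.* n))

    colourings-cyc : ∀ k → colourings (cyc (suc k)) ≡ + N
    colourings-cyc zero    = trans (colourings-restrict {α = cyc 1} refl (λ ())) (ℤ.*-identityʳ (+ N))
    colourings-cyc (suc k) =
      trans (colourings-merge {α = cyc (suc (suc k))} refl)
            (trans (colourings-cong (cyc-merge k)) (colourings-cyc k))

    χ-evalU : ∀ P → χ (evalU N P) ≡ evalCN (+ N) P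
    χ-evalU (coef a) = refl
    χ-evalU varN     = refl
    χ-evalU (varC k) = trans (χ-wGLN (suc k) (cyc (suc k))) (colourings-cyc k)
    χ-evalU (p :+ q) = cong₂ _+_ (χ-evalU p) (χ-evalU q)
    χ-evalU (p :* q) = cong₂ _*_ (χ-evalU p) (χ-evalU q)
    χ-evalU (:- p)   = cong -_ (χ-evalU p)

open import Defs
open import Data.Nat using (ℕ; _*_)
open import Data.Integer using (ℤ; _^_)
open import Relation.Binary.PropositionalEquality using (_≡_)
import Data.Nat as ℕ
import Data.Nat.Properties as ℕ
import Data.Integer as ℤ
open import Relation.Binary.PropositionalEquality using (refl; module ≡-Reasoning)

open FiniteDifferences
open TraceCharacter

degree : Poly → ℕ
degree (coef _) = 0
degree varN     = 1
degree (varC _) = 1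
degree (p :+ q) = degree p ℕ.⊔ degree q
degree (p :* q) = degree p ℕ.+ degree q
degree (:- p)   = degree p

Degree≤-evalCN : ∀ P → Degree≤ (degree P) (λ x → evalCN x P)
Degree≤-evalCN (coef _) = constant (λ _ → refl)
Degree≤-evalCN varN     = Degree≤-id
Degree≤-evalCN (varC _) = Degree≤-id
Degree≤-evalCN (p :+ q) = Degree≤-+ (Degree≤-weaken (ℕ.m≤m⊔n _ _) (Degree≤-evalCN p))
                                    (Degree≤-weaken (ℕ.m≤n⊔m _ _) (Degree≤-evalCN q))
Degree≤-evalCN (p :* q) = Degree≤-* (Degree≤-evalCN p) (Degree≤-evalCN q)
Degree≤-evalCN (:- p)   = Degree≤-neg (Degree≤-evalCN p)

mainTheorem8 : (n : ℕ) (B : ChordDiagram n) (P : Poly) →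
    IsUniversalGL (2 * n) (α B) P →
    (N : ℤ) → evalCN N P ≡ N ^ n
mainTheorem8 n B P P-universal = agreeOnPositives⇒≗ (Degree≤-evalCN P) (Degree≤-^ n) λ k →
  let N = ℕ.suc k in begin
    evalCN (ℤ.+ N) P             ≡⟨ χ-evalU N P ⟨
    χ (evalU N P)                ≡⟨ χ-resp-≈U (P-universal N) ⟩
    χ (wGLN N (2 * n) (α B))     ≡⟨ χ-wGLN N (2 * n) (α B) ⟩
    colourings N (α B)           ≡⟨ colourings-fixedPointFree N n (involutive B) (fixedPtFree B) ⟩
    (ℤ.+ N) ^ n                  ∎
  where open ≡-Reasoning
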